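{- Let $n>2$ be an integer and $r\ge1$ an integer with $2^r+1<2^n$, let $s_i=(2^r+1)2^{n+i}+1$ for $i\in\mathbb{N}$, and let $S=P_{2^r+1}(n)$. Then $w(1)=\max\big(\mathrm{Ap}(S,s_0)\big)$.
   Context: $P_{2^r+1}(n)$ is the numerical semigroup consisting of all finite non-negative integer linear combinations of $\{(2^r+1)2^{n+i}+1\mid i\in\mathbb{N}\}$. For nonzero $m\in S$, $\mathrm{Ap}(S,m)=\{s\in S\mid s-m\notin S\}$. For an integer $i$, $w(i)$ denotes the least element of $S$ congruent to $i$ modulo $s_0$; one has $\mathrm{Ap}(S,s_0)=\{w(0),\dots,w(s_0-1)\}$. -}

module Defs where

open import Data.Nat using (ℕ; zero; suc; _+_; _*_; _∸_; _^_; _≤_; _<_; NonZero)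
open import Data.Nat.DivMod using (_%_)
open import Data.List using (List; map)
open import Data.Nat.ListAction using (sum)
open import Data.Product using (Σ; ∃; _×_)
open import Relation.Nullary using (¬_)
open import Relation.Binary.PropositionalEquality using (_≡_)

-- generators s_i = (2^r + 1) 2^(n+i) + 1 of P_{2^r+1}(n)  (written suc for NonZero)
gen : (r n i : ℕ) → ℕ
gen r n i = suc ((2 ^ r + 1) * 2 ^ (n + i))

-- x ∈ P_{2^r+1}(n): x is a finite non-negative integer combination of the
-- generators, i.e. the sum of the generators indexed by some finite list
-- (a multiset) of indices.
InP : (r n x : ℕ) → Set
InP r n x = Σ (List ℕ) λ is → sum (map (gen r n) is) ≡ x

-- Apéry set Ap(S, m) = { s ∈ S | s - m ∉ S } (s - m taken in ℤ; if s < m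
-- it is negative, hence not in S).
InAp : (S : ℕ → Set) (m s : ℕ) → Set
InAp S m s = S s × ¬ (m ≤ s × S (s ∸ m))

IsW : (S : ℕ → Set) (m : ℕ) .{{_ : NonZero m}} (i w : ℕ) → Set
IsW S m i w = S w × (w % m ≡ i % m) × (∀ x → S x → x % m ≡ i % m → w ≤ x)

IsMax : (A : ℕ → Set) (w : ℕ) → Set
IsMax A w = A w × (∀ a → A a → a ≤ w)

-- Write K = s₀ − 1 = (2^r + 1) 2^n, so that s_i = 1 + K 2^i and the elements of S
-- are the numbers K T + k with T a sum of k powers of two (hence k ≤ T).  As
-- K ≡ −1 modulo s₀, such an element is ≡ 1 exactly when s₀ divides T − k + 1.
-- Then either T = k + K, and k ≥ 4 because for k ≤ 3 the number k + K has more
-- than k binary digits one (K has two of them, as n ≥ 2 and r ≥ 1), or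
-- T > k + 2K.  Either way the element is at least K (K + 4) + 4, which is
-- s_{n+r} + s_n + 2 s₁, so this is w(1).  Every integer ≥ K (K + 3) + 4 lies in S
-- (split the summands of K + 3 = 2^{n+r} + 2^n + 2 + 1, then add multiples of s₀),
-- so no element of S above w(1) lies in Ap(S, s₀).

module Submission where

open import Defs
open import Data.Nat using (ℕ; zero; suc; _+_; _*_; _∸_; _^_; _%_; _/_; _<_; _≤_; _≤?_; z≤n; s≤s; z<s)
open import Data.Nat.Properties
open import Data.Nat.DivMod using (m≡m%n+[m/n]*n; m<n⇒m%n≡m; m%n<n; [m+kn]%n≡m%n; m≤n⇒[n∸m]%m≡n%m)
open import Data.Nat.Divisibility using (_∣_; divides; ∣m+n∣m⇒∣n; m∣m*n; n∣m*n)
open import Data.Nat.ListAction using (sum)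
open import Data.Nat.Tactic.RingSolver using (solve-∀)
open import Data.List using (List; []; _∷_; map; length)
open import Data.Product using (∃; _×_; _,_)
open import Data.Sum using (_⊎_; inj₁; inj₂)
open import Data.Empty using (⊥-elim)
open import Function using (_∘_; flip)
open import Relation.Nullary using (¬_; yes; no)
open import Relation.Binary.PropositionalEquality
open import Algebra.Properties.CommutativeSemigroup *-commutativeSemigroup using (x∙yz≈y∙xz)

sumPow2 : List ℕ → ℕ
sumPow2 is = sum (map (2 ^_) is)

length≤sumPow2 : ∀ is → length is ≤ sumPow2 is
length≤sumPow2 []       = z≤n
length≤sumPow2 (i ∷ is) = +-mono-≤ (m^n>0 2 i) (length≤sumPow2 is)

sumPow2-map-suc : ∀ is → sumPow2 (map suc is) ≡ 2 * sumPow2 is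
sumPow2-map-suc []       = refl
sumPow2-map-suc (i ∷ is) =
  trans (cong (2 * 2 ^ i +_) (sumPow2-map-suc is)) (sym (*-distribˡ-+ 2 (2 ^ i) (sumPow2 is)))

sumPow2-map-suc≢odd : ∀ is m → sumPow2 (map suc is) ≢ suc (2 * m)
sumPow2-map-suc≢odd is m = even≢odd (sumPow2 is) m ∘ trans (sym (sumPow2-map-suc is))

sumPow2-split : ∀ is → length is < sumPow2 is →
                ∃ λ js → length js ≡ suc (length is) × sumPow2 js ≡ sumPow2 is
sumPow2-split (zero ∷ is) (s≤s len<sum) with sumPow2-split is len<sum
... | js , len , sum≡ = zero ∷ js , cong suc len , cong suc sum≡
sumPow2-split (suc j ∷ is) _ =
  j ∷ j ∷ is , refl , doubling (2 ^ j) (sumPow2 is)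
  where
  doubling : ∀ a s → a + (a + s) ≡ 2 * a + s
  doubling = solve-∀

sumPow2-lengthen : ∀ d is → length is + d ≤ sumPow2 is →
                   ∃ λ js → length js ≡ length is + d × sumPow2 js ≡ sumPow2 is
sumPow2-lengthen zero    is _ = is , sym (+-identityʳ (length is)) , refl
sumPow2-lengthen (suc d) is len+d<sum
  with sumPow2-split is (≤-trans (m<m+n (length is) z<s) len+d<sum)
... | js , len , sum≡
  with sumPow2-lengthen d js (subst₂ (λ l s → l + d ≤ s) (sym len) (sym sum≡)
                               (subst (_≤ sumPow2 is) (+-suc (length is) d) len+d<sum))
... | ks , len′ , sum≡′ =
  ks , trans len′ (trans (cong (_+ d) len) (sym (+-suc (length is) d))) , trans sum≡′ sum≡

IsPow2 : ℕ → Set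
IsPow2 x = ∃ λ j → 2 ^ j ≡ x

IsPow2-half : ∀ x → IsPow2 (2 * x) → IsPow2 x
IsPow2-half x (zero  , eq) = ⊥-elim (even≢odd x 0 (sym eq))
IsPow2-half x (suc j , eq) = j , *-cancelˡ-≡ (2 ^ j) x 2 eq

¬IsPow2-odd : ∀ t → 1 ≤ t → ¬ IsPow2 (2 * t + 1)
¬IsPow2-odd (suc t) _ (zero  , eq) = 0≢1+n (suc-injective (trans eq (+-comm (2 * suc t) 1)))
¬IsPow2-odd t       _ (suc j , eq) = even≢odd (2 ^ j) t (trans eq (+-comm (2 * t) 1))

¬IsPow2-*2^ : ∀ x e → ¬ IsPow2 x → ¬ IsPow2 (x * 2 ^ e)
¬IsPow2-*2^ x zero    ¬pow2 = ¬pow2 ∘ subst IsPow2 (*-identityʳ x)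
¬IsPow2-*2^ x (suc e) ¬pow2 =
  ¬IsPow2-*2^ x e ¬pow2 ∘ IsPow2-half (x * 2 ^ e) ∘ subst IsPow2 (x∙yz≈y∙xz x 2 (2 ^ e))

-- Parity: an odd sum of powers of two contains 2⁰, and one without 2⁰ can be halved.
module FewPowersOfTwo {L : ℕ} (L≢0 : L ≢ 0) (¬pow2 : ¬ IsPow2 L) where

  private
    M : ℕ
    M = 2 * L

    M≢0 : M ≢ 0
    M≢0 = L≢0 ∘ *-cancelˡ-≡ L 0 2

    2M≢0 : 2 * M ≢ 0
    2M≢0 = M≢0 ∘ *-cancelˡ-≡ M 0 2

  two-powers≢odd : ∀ i j → sumPow2 (i ∷ j ∷ []) ≢ suc M
  two-powers≢odd zero    zero    eq = even≢odd L 0 (sym (suc-injective eq))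
  two-powers≢odd zero    (suc j) eq = ¬pow2 (IsPow2-half L (suc j , trans (sym (+-identityʳ _)) (suc-injective eq)))
  two-powers≢odd (suc i) zero    eq = two-powers≢odd zero (suc i) (trans (sym (+-suc _ 0)) eq)
  two-powers≢odd (suc i) (suc j) eq = sumPow2-map-suc≢odd (i ∷ j ∷ []) L eq

  one-power≢ : ∀ i → sumPow2 (i ∷ []) ≢ suc (2 * M)
  one-power≢ zero    eq = 2M≢0 (sym (suc-injective eq))
  one-power≢ (suc i) eq = sumPow2-map-suc≢odd (i ∷ []) M eq

  two-powers≢ : ∀ i j → sumPow2 (i ∷ j ∷ []) ≢ 2 + 2 * M
  two-powers≢ zero    zero    eq = 2M≢0 (sym (suc-injective (suc-injective eq)))
  two-powers≢ zero    (suc j) eq = one-power≢ (suc j) (suc-injective eq)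
  two-powers≢ (suc i) zero    eq = one-power≢ (suc i) (suc-injective (trans (sym (+-suc _ 0)) eq))
  two-powers≢ (suc i) (suc j) eq =
    two-powers≢odd i j (*-cancelˡ-≡ _ _ 2 (trans (sym (sumPow2-map-suc (i ∷ j ∷ []))) (trans eq (sym (*-suc 2 M)))))

  three-powers≢ : ∀ i j l → sumPow2 (i ∷ j ∷ l ∷ []) ≢ 3 + 2 * M
  three-powers≢ zero    j       l       eq = two-powers≢ j l (suc-injective eq)
  three-powers≢ (suc i) zero    l       eq = two-powers≢ (suc i) l (suc-injective (trans (sym (+-suc _ _)) eq))
  three-powers≢ (suc i) (suc j) zero    eq =
    two-powers≢ (suc i) (suc j) (suc-injective (trans (sym (trans (cong (2 ^ suc i +_) (+-suc _ 0)) (+-suc _ _))) eq))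
  three-powers≢ (suc i) (suc j) (suc l) eq =
    sumPow2-map-suc≢odd (i ∷ j ∷ l ∷ []) (suc M) (trans eq (cong suc (sym (*-suc 2 M))))

  4≤length : ∀ is → sumPow2 is ≡ length is + 2 * M → 4 ≤ length is
  4≤length []                  eq = ⊥-elim (2M≢0 (sym eq))
  4≤length (i ∷ [])            eq = ⊥-elim (one-power≢ i eq)
  4≤length (i ∷ j ∷ [])        eq = ⊥-elim (two-powers≢ i j eq)
  4≤length (i ∷ j ∷ l ∷ [])    eq = ⊥-elim (three-powers≢ i j l eq)
  4≤length (_ ∷ _ ∷ _ ∷ _ ∷ _) _  = s≤s (s≤s (s≤s (s≤s z≤n)))

sucK∣suc[T∸k] : ∀ K T k q → k ≤ T → K * T + k ≡ 1 + q * suc K → suc K ∣ suc (T ∸ k)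
sucK∣suc[T∸k] K T k q k≤T KT+k≡ = ∣m+n∣m⇒∣n (subst (suc K ∣_) sucK*T≡ (m∣m*n T)) (n∣m*n q)
  where
  open ≡-Reasoning
  d : ℕ
  d = T ∸ k
  sucK*T≡ : suc K * T ≡ q * suc K + suc d
  sucK*T≡ = begin
    T + K * T            ≡⟨ cong (_+ K * T) (sym (m+[n∸m]≡n k≤T)) ⟩
    k + d + K * T        ≡⟨ trans (cong (_+ K * T) (+-comm k d)) (trans (+-assoc d k (K * T)) (cong (d +_) (+-comm k (K * T)))) ⟩
    d + (K * T + k)      ≡⟨ cong (d +_) KT+k≡ ⟩
    d + (1 + q * suc K)  ≡⟨ trans (+-comm d (suc (q * suc K))) (sym (+-suc (q * suc K) d)) ⟩
    q * suc K + suc d    ∎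

sucK∣sucd⇒d≡K⊎2K<d : ∀ {K d} → suc K ∣ suc d → d ≡ K ⊎ K + K < d
sucK∣sucd⇒d≡K⊎2K<d (divides 1 eq) = inj₁ (trans (suc-injective eq) (+-identityʳ _))
sucK∣sucd⇒d≡K⊎2K<d {K} (divides (suc (suc j)) eq) = inj₂ (begin
  suc (K + K)                ≡⟨ +-suc K K ⟨
  K + suc K                  ≤⟨ +-monoʳ-≤ K (m≤m+n (suc K) (j * suc K)) ⟩
  K + (suc K + j * suc K)    ≡⟨ suc-injective eq ⟨
  _                          ∎)
  where open ≤-Reasoning

w₁ : ℕ → ℕ
w₁ K = K * (K + 4) + 4

w₁%sucK : ∀ K → w₁ K % suc K ≡ 1 % suc K
w₁%sucK K = trans (cong (_% suc K) (w₁≡ K)) ([m+kn]%n≡m%n 1 (K + 3) (suc K))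
  where
  w₁≡ : ∀ K → K * (K + 4) + 4 ≡ 1 + (K + 3) * suc K
  w₁≡ = solve-∀

w₁≤K*[1+2K] : ∀ {K} → 4 ≤ K → w₁ K ≤ K * suc (K + K)
w₁≤K*[1+2K] {K} K≥4 = begin
  K * (K + 4) + 4      ≡⟨ expand K ⟩
  K * K + K * 4 + 4    ≤⟨ +-mono-≤ (+-monoʳ-≤ (K * K) (*-monoʳ-≤ K K≥4)) K≥4 ⟩
  K * K + K * K + K    ≡⟨ collect K ⟩
  K * suc (K + K)      ∎
  where
  open ≤-Reasoning
  expand : ∀ K → K * (K + 4) + 4 ≡ K * K + K * 4 + 4
  expand = solve-∀
  collect : ∀ K → K * K + K * K + K ≡ K * suc (K + K)
  collect = solve-∀

w₁-least : ∀ {K} → 4 ≤ K → (∀ is → sumPow2 is ≡ length is + K → 4 ≤ length is) →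
           ∀ is → (K * sumPow2 is + length is) % suc K ≡ 1 % suc K →
           w₁ K ≤ K * sumPow2 is + length is
w₁-least {K} K≥4 few is residue
  with sucK∣sucd⇒d≡K⊎2K<d (sucK∣suc[T∸k] K T k q k≤T x≡)
  where
  T k q : ℕ
  T = sumPow2 is
  k = length is
  q = (K * T + k) / suc K
  k≤T : k ≤ T
  k≤T = length≤sumPow2 is
  x≡ : K * T + k ≡ 1 + q * suc K
  x≡ = trans (m≡m%n+[m/n]*n (K * T + k) (suc K))
             (cong (_+ q * suc K) (trans residue (m<n⇒m%n≡m (s≤s (≤-trans (s≤s z≤n) K≥4)))))
... | inj₁ d≡K = +-mono-≤ (*-monoʳ-≤ K K+4≤T) k≥4
  where
  T≡ : sumPow2 is ≡ length is + K
  T≡ = trans (sym (m+[n∸m]≡n (length≤sumPow2 is))) (cong (length is +_) d≡K)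
  k≥4 : 4 ≤ length is
  k≥4 = few is T≡
  K+4≤T : K + 4 ≤ sumPow2 is
  K+4≤T = subst (K + 4 ≤_) (trans (+-comm K (length is)) (sym T≡)) (+-monoʳ-≤ K k≥4)
... | inj₂ 2K<d = begin
  w₁ K                                      ≤⟨ w₁≤K*[1+2K] K≥4 ⟩
  K * suc (K + K)                           ≤⟨ *-monoʳ-≤ K (≤-trans 2K<d (m∸n≤m (sumPow2 is) (length is))) ⟩
  K * sumPow2 is                            ≤⟨ m≤m+n (K * sumPow2 is) (length is) ⟩
  K * sumPow2 is + length is                ∎
  where open ≤-Reasoning

module Generators (r n : ℕ) where

  -- With n + 0 rather than n, gen r n 0 is definitionally suc K.
  K : ℕ
  K = (2 ^ r + 1) * 2 ^ (n + 0)

  gen≡ : ∀ i → gen r n i ≡ suc (K * 2 ^ i)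
  gen≡ i = cong suc (begin
    (2 ^ r + 1) * 2 ^ (n + i)            ≡⟨ cong (λ e → (2 ^ r + 1) * 2 ^ (e + i)) (+-identityʳ n) ⟨
    (2 ^ r + 1) * 2 ^ (n + 0 + i)        ≡⟨ cong ((2 ^ r + 1) *_) (^-distribˡ-+-* 2 (n + 0) i) ⟩
    (2 ^ r + 1) * (2 ^ (n + 0) * 2 ^ i)  ≡⟨ *-assoc (2 ^ r + 1) (2 ^ (n + 0)) (2 ^ i) ⟨
    K * 2 ^ i                            ∎)
    where open ≡-Reasoning

  sum-gen : ∀ is → sum (map (gen r n) is) ≡ K * sumPow2 is + length is
  sum-gen []       = cong (_+ 0) (sym (*-zeroʳ K))
  sum-gen (i ∷ is) = trans (cong₂ _+_ (gen≡ i) (sum-gen is)) (regroup K (2 ^ i) (sumPow2 is) (length is))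
    where
    regroup : ∀ K a T k → suc (K * a) + (K * T + k) ≡ K * (a + T) + suc k
    regroup = solve-∀

  InP-sumPow2 : ∀ is → InP r n (K * sumPow2 is + length is)
  InP-sumPow2 is = is , sum-gen is

  w₁-least-InP : 4 ≤ K → (∀ is → sumPow2 is ≡ length is + K → 4 ≤ length is) →
                 ∀ x → InP r n x → x % suc K ≡ 1 % suc K → w₁ K ≤ x
  w₁-least-InP K≥4 few x (is , sum≡x) residue =
    subst (w₁ K ≤_) x≡ (w₁-least K≥4 few is (subst (λ y → y % suc K ≡ 1 % suc K) (sym x≡) residue))
    where
    x≡ : K * sumPow2 is + length is ≡ x
    x≡ = trans (sym (sum-gen is)) sum≡x

  sumPow2-base : ∀ a → sumPow2 (r + (n + 0) ∷ n + 0 ∷ 1 ∷ a ∷ []) ≡ K + 2 + 2 ^ a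
  sumPow2-base a =
    trans (cong (_+ (N + (2 + (2 ^ a + 0)))) (^-distribˡ-+-* 2 r (n + 0))) (collect (2 ^ r) N (2 ^ a))
    where
    N : ℕ
    N = 2 ^ (n + 0)
    collect : ∀ R N A → R * N + (N + (2 + (A + 0))) ≡ (R + 1) * N + 2 + A
    collect = solve-∀

  InP-w₁ : InP r n (w₁ K)
  InP-w₁ = subst (λ T → InP r n (K * T + 4)) (trans (sumPow2-base 1) (+-assoc K 2 2))
                 (InP-sumPow2 (r + (n + 0) ∷ n + 0 ∷ 1 ∷ 1 ∷ []))

  InP-window< : ∀ c → c < K → InP r n (K * (K + 3) + (4 + c))
  InP-window< c c<K with sumPow2-lengthen c base (subst (4 + c ≤_) (sym base≡) (+-monoʳ-≤ 3 c<K))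
    where
    base : List ℕ
    base = r + (n + 0) ∷ n + 0 ∷ 1 ∷ 0 ∷ []
    base≡ : sumPow2 base ≡ 3 + K
    base≡ = trans (sumPow2-base 0) (trans (+-assoc K 2 1) (+-comm K 3))
  ... | js , len≡ , sum≡ =
    subst (InP r n) (cong₂ (λ T l → K * T + l) (trans sum≡ (trans (sumPow2-base 0) (+-assoc K 2 1))) len≡)
          (InP-sumPow2 js)

  InP-window : ∀ c → c ≤ K → InP r n (K * (K + 3) + (4 + c))
  InP-window c c≤K with m≤n⇒m<n∨m≡n c≤K
  ... | inj₁ c<K  = InP-window< c c<K
  ... | inj₂ refl = subst (InP r n) (sym (w₁≡ K)) InP-w₁
    where
    w₁≡ : ∀ K → K * (K + 3) + (4 + K) ≡ K * (K + 4) + 4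
    w₁≡ = solve-∀

  InP-q*s₀+ : ∀ q x → InP r n x → InP r n (q * suc K + x)
  InP-q*s₀+ zero    x x∈S = x∈S
  InP-q*s₀+ (suc q) x x∈S with InP-q*s₀+ q x x∈S
  ... | is , sum≡ = 0 ∷ is , trans (cong (suc K +_) sum≡) (sym (+-assoc (suc K) (q * suc K) x))

  InP-≥ : ∀ x → K * (K + 3) + 4 ≤ x → InP r n x
  InP-≥ x x≥ = subst (InP r n) x≡ (InP-q*s₀+ q _ (InP-window c c≤K))
    where
    F c q : ℕ
    F = K * (K + 3) + 4
    c = (x ∸ F) % suc K
    q = (x ∸ F) / suc K
    c≤K : c ≤ K
    c≤K = <⇒≤pred (m%n<n (x ∸ F) (suc K))
    x≡ : q * suc K + (K * (K + 3) + (4 + c)) ≡ x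
    x≡ = begin
      q * suc K + (K * (K + 3) + (4 + c))  ≡⟨ regroup (q * suc K) (K * (K + 3)) c ⟩
      F + (c + q * suc K)                  ≡⟨ cong (F +_) (m≡m%n+[m/n]*n (x ∸ F) (suc K)) ⟨
      F + (x ∸ F)                          ≡⟨ m+[n∸m]≡n x≥ ⟩
      x                                    ∎
      where
      open ≡-Reasoning
      regroup : ∀ Q A c → Q + (A + (4 + c)) ≡ A + 4 + (c + Q)
      regroup = solve-∀

  w₁∈Ap : (∀ x → InP r n x → x % suc K ≡ 1 % suc K → w₁ K ≤ x) → InAp (InP r n) (suc K) (w₁ K)
  w₁∈Ap least = InP-w₁ , λ (sucK≤w₁ , shift∈S) →
    <⇒≱ (∸-monoʳ-< z<s sucK≤w₁)
        (least _ shift∈S (trans (m≤n⇒[n∸m]%m≡n%m sucK≤w₁) (w₁%sucK K)))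

  w₁-max : ∀ y → InAp (InP r n) (suc K) y → y ≤ w₁ K
  w₁-max y (_ , ¬shift∈S) with y ≤? w₁ K
  ... | yes y≤w₁ = y≤w₁
  ... | no  y≰w₁ = ⊥-elim (¬shift∈S (sucK≤y , InP-≥ (y ∸ suc K) F≤y∸sucK))
    where
    F : ℕ
    F = K * (K + 3) + 4
    F+sucK≤y : F + suc K ≤ y
    F+sucK≤y = subst (_≤ y) (w₁≡ K) (≰⇒> y≰w₁)
      where
      w₁≡ : ∀ K → suc (K * (K + 4) + 4) ≡ K * (K + 3) + 4 + suc K
      w₁≡ = solve-∀
    sucK≤y : suc K ≤ y
    sucK≤y = ≤-trans (m≤n+m (suc K) F) F+sucK≤y
    F≤y∸sucK : F ≤ y ∸ suc K
    F≤y∸sucK = subst (_≤ y ∸ suc K) (m+n∸n≡m F (suc K)) (∸-monoˡ-≤ (suc K) F+sucK≤y)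

lemma14 : (n r : ℕ) → 2 < n → 1 ≤ r → 2 ^ r + 1 < 2 ^ n →
    ∃ λ w → IsW (InP r n) (gen r n 0) 1 w × IsMax (InAp (InP r n) (gen r n 0)) w
lemma14 n@(suc (suc (suc n′))) r@(suc r′) (s≤s (s≤s (s≤s _))) (s≤s z≤n) _ =
  w₁ K , (InP-w₁ , w₁%sucK K , least) , w₁∈Ap least , w₁-max
  where
  open Generators r n
  L : ℕ
  L = (2 ^ r + 1) * 2 ^ (suc n′ + 0)
  K≡4L : K ≡ 2 * (2 * L)
  K≡4L = trans (x∙yz≈y∙xz (2 ^ r + 1) 2 _) (cong (2 *_) (x∙yz≈y∙xz (2 ^ r + 1) 2 _))
  ¬pow2 : ¬ IsPow2 L
  ¬pow2 = ¬IsPow2-*2^ (2 ^ r + 1) (suc n′ + 0) (¬IsPow2-odd (2 ^ r′) (m^n>0 2 r′))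
  L≢0 : L ≢ 0
  L≢0 = m+1+n≢0 (2 ^ r) ∘ m*n≡0⇒m≡0 (2 ^ r + 1) (2 ^ (suc n′ + 0)) {{m^n≢0 2 (suc n′ + 0)}}
  least : ∀ x → InP r n x → x % suc K ≡ 1 % suc K → w₁ K ≤ x
  least = w₁-least-InP (subst (4 ≤_) (sym K≡4L) (*-monoʳ-≤ 2 (*-monoʳ-≤ 2 (n≢0⇒n>0 L≢0))))
                       (λ is → FewPowersOfTwo.4≤length L≢0 ¬pow2 is ∘ flip trans (cong (length is +_) K≡4L))
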